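{- Let $C$ be an application context and $\varphi,\psi$ patterns. Then, in $\mathcal{MG}^c$: (i) $\vdash C[\bot]\leftrightarrow\bot$; (ii) $\vdash C[\varphi\vee\psi]\leftrightarrow C[\varphi]\vee C[\psi]$; (iii) $\vdash C[\exists x\varphi]\leftrightarrow\exists x\,C[\varphi]$ for every element variable $x\notin FV(C[\exists x\varphi])$.
   Context: Fix a countably infinite set $EVar$ of element variables and a set $\Sigma$ of constant symbols containing a distinguished "definedness symbol" $\lceil\,\rceil$. Patterns: $\varphi::= x\mid \sigma\mid \bot\mid \neg\varphi\mid \varphi\to\varphi\mid \varphi\wedge\varphi\mid\varphi\vee\varphi\mid \varphi\cdot\varphi\mid \forall x\varphi\mid\exists x\varphi$ ($\varphi\cdot\psi$ is application). Abbreviations: $\varphi\leftrightarrow\psi:=(\varphi\to\psi)\wedge(\psi\to\varphi)$, $\lceil\varphi\rceil:=\lceil\,\rceil\cdot\varphi$, $\lfloor\varphi\rfloor:=\neg\lceil\neg\varphi\rceil$, $\varphi=\psi:=\lfloor\varphi\leftrightarrow\psi\rfloor$. $FV(\varphi)$ is the set of variables with a free occurrence (an occurrence of $x$ is bound if inside $\forall x\eta$ or $\exists x\eta$). Application contexts are generated by $C::=\Box\mid C\cdot\chi\mid \chi\cdot C$ ($\chi$ a pattern); $C[\delta]$ is the pattern obtained by replacing $\Box$ by $\delta$. $\vdash\psi$ means there is a finite sequence ending in $\psi$ of axiom instances or consequences of earlier members by rules. Proof system $\mathcal{MG}^c$. Axioms: $\varphi\vee\varphi\to\varphi$; $\varphi\to\varphi\wedge\varphi$;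 $\varphi\to\varphi\vee\psi$; $\varphi\wedge\psi\to\varphi$; $\varphi\vee\psi\to\psi\vee\varphi$; $\varphi\wedge\psi\to\psi\wedge\varphi$; $\bot\to\varphi$; $\varphi\vee\neg\varphi$; $\neg\varphi\to(\varphi\to\bot)$; $(\varphi\to\bot)\to\neg\varphi$; $\forall x(\varphi\to\psi)\to(\forall x\varphi\to\forall x\psi)$; $\varphi\to\forall x\varphi$ if $x$ does not occur in $\varphi$; $\exists x(x=y)$ for $y$ distinct from $x$; $\exists x\varphi\to\neg\forall x\neg\varphi$; $\neg\forall x\neg\varphi\to\exists x\varphi$; $(\varphi\vee\psi)\cdot\chi\to\varphi\cdot\chi\vee\psi\cdot\chi$; $\chi\cdot(\varphi\vee\psi)\to\chi\cdot\varphi\vee\chi\cdot\psi$; $(\exists x\varphi)\cdot\psi\to\exists x(\varphi\cdot\psi)$ and $\psi\cdot(\exists x\varphi)\to\exists x(\psi\cdot\varphi)$ if $x$ does not occur in $\psi$; $\lceil\varphi\rceil\cdot\psi\to\lceil\varphi\rceil$; $\psi\cdot\lceil\varphi\rceil\to\lceil\varphi\rceil$; $\lceil x\rceil$; $\varphi\to\lceil\varphi\rceil$; $\lceil\bot\rceil\to\bot$. Rules: from $\varphi$, $\varphi\to\psi$ infer $\psi$; from $\varphi\to\psi$, $\psi\to\chi$ infer $\varphi\to\chi$; from $\varphi\wedge\psi\to\chi$ infer $\varphi\to(\psi\to\chi)$; from $\varphi\to(\psi\to\chi)$ infer $\varphi\wedge\psi\to\chi$; from $\varphi\to\psi$ infer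 $\chi\vee\varphi\to\chi\vee\psi$; from $\varphi$ infer $\forall x\varphi$; from $\varphi\to\psi$ infer $\varphi\cdot\chi\to\psi\cdot\chi$ and $\chi\cdot\varphi\to\chi\cdot\psi$. -}

module Defs where

open import Data.Nat using (ℕ)
open import Relation.Binary.PropositionalEquality using (_≡_)
open import Relation.Nullary using (¬_)

EVar : Set
EVar = ℕ

data Pat (S : Set) : Set where
  var   : EVar → Pat S
  sym   : S → Pat S
  ⊥p    : Pat S
  ¬p_   : Pat S → Pat S
  _⇒_   : Pat S → Pat S → Pat S
  _∧p_  : Pat S → Pat S → Pat S
  _∨p_  : Pat S → Pat S → Pat S
  _·_   : Pat S → Pat S → Pat S
  ∀p    : EVar → Pat S → Pat S
  ∃p    : EVar → Pat S → Pat S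

infixr 4 _⇒_
infixr 6 _∨p_
infixr 7 _∧p_
infixl 9 _·_
infix 8 ¬p_

module _ {S : Set} where

  infix 3 _⇔_
  _⇔_ : Pat S → Pat S → Pat S
  φ ⇔ ψ = (φ ⇒ ψ) ∧p (ψ ⇒ φ)

  data Occurs (x : EVar) : Pat S → Set where
    o-var : Occurs x (var x)
    o-¬   : ∀ {φ} → Occurs x φ → Occurs x (¬p φ)
    o-⇒l  : ∀ {φ ψ} → Occurs x φ → Occurs x (φ ⇒ ψ)
    o-⇒r  : ∀ {φ ψ} → Occurs x ψ → Occurs x (φ ⇒ ψ)
    o-∧l  : ∀ {φ ψ} → Occurs x φ → Occurs x (φ ∧p ψ)
    o-∧r  : ∀ {φ ψ} → Occurs x ψ → Occurs x (φ ∧p ψ)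
    o-∨l  : ∀ {φ ψ} → Occurs x φ → Occurs x (φ ∨p ψ)
    o-∨r  : ∀ {φ ψ} → Occurs x ψ → Occurs x (φ ∨p ψ)
    o-·l  : ∀ {φ ψ} → Occurs x φ → Occurs x (φ · ψ)
    o-·r  : ∀ {φ ψ} → Occurs x ψ → Occurs x (φ · ψ)
    o-∀b  : ∀ {φ} → Occurs x (∀p x φ)
    o-∀   : ∀ {y φ} → Occurs x φ → Occurs x (∀p y φ)
    o-∃b  : ∀ {φ} → Occurs x (∃p x φ)
    o-∃   : ∀ {y φ} → Occurs x φ → Occurs x (∃p y φ)

  data FreeIn (x : EVar) : Pat S → Set where
    f-var : FreeIn x (var x)
    f-¬   : ∀ {φ} → FreeIn x φ → FreeIn x (¬p φ)
    f-⇒l  : ∀ {φ ψ} → FreeIn x φ → FreeIn x (φ ⇒ ψ)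
    f-⇒r  : ∀ {φ ψ} → FreeIn x ψ → FreeIn x (φ ⇒ ψ)
    f-∧l  : ∀ {φ ψ} → FreeIn x φ → FreeIn x (φ ∧p ψ)
    f-∧r  : ∀ {φ ψ} → FreeIn x ψ → FreeIn x (φ ∧p ψ)
    f-∨l  : ∀ {φ ψ} → FreeIn x φ → FreeIn x (φ ∨p ψ)
    f-∨r  : ∀ {φ ψ} → FreeIn x ψ → FreeIn x (φ ∨p ψ)
    f-·l  : ∀ {φ ψ} → FreeIn x φ → FreeIn x (φ · ψ)
    f-·r  : ∀ {φ ψ} → FreeIn x ψ → FreeIn x (φ · ψ)
    f-∀   : ∀ {y φ} → ¬ (x ≡ y) → FreeIn x φ → FreeIn x (∀p y φ)
    f-∃   : ∀ {y φ} → ¬ (x ≡ y) → FreeIn x φ → FreeIn x (∃p y φ)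

  data Ctx : Set where
    □    : Ctx
    _·ₗ_ : Ctx → Pat S → Ctx
    _·ᵣ_ : Pat S → Ctx → Ctx

  _[_] : Ctx → Pat S → Pat S
  □ [ δ ] = δ
  (C ·ₗ χ) [ δ ] = (C [ δ ]) · χ
  (χ ·ᵣ C) [ δ ] = χ · (C [ δ ])

module MG {S : Set} (d : S) where

  ⌈_⌉ : Pat S → Pat S
  ⌈ φ ⌉ = sym d · φ

  ⌊_⌋ : Pat S → Pat S
  ⌊ φ ⌋ = ¬p ⌈ ¬p φ ⌉

  _≐_ : Pat S → Pat S → Pat S
  φ ≐ ψ = ⌊ φ ⇔ ψ ⌋

  data ⊢_ : Pat S → Set where
    ax-∨idem  : ∀ φ → ⊢ (φ ∨p φ ⇒ φ)
    ax-∧dup   : ∀ φ → ⊢ (φ ⇒ φ ∧p φ)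
    ax-∨intro : ∀ φ ψ → ⊢ (φ ⇒ φ ∨p ψ)
    ax-∧elim  : ∀ φ ψ → ⊢ (φ ∧p ψ ⇒ φ)
    ax-∨comm  : ∀ φ ψ → ⊢ (φ ∨p ψ ⇒ ψ ∨p φ)
    ax-∧comm  : ∀ φ ψ → ⊢ (φ ∧p ψ ⇒ ψ ∧p φ)
    ax-⊥      : ∀ φ → ⊢ (⊥p ⇒ φ)
    ax-lem    : ∀ φ → ⊢ (φ ∨p ¬p φ)
    ax-¬→     : ∀ φ → ⊢ (¬p φ ⇒ (φ ⇒ ⊥p))
    ax-→¬     : ∀ φ → ⊢ ((φ ⇒ ⊥p) ⇒ ¬p φ)
    ax-K∀     : ∀ x φ ψ → ⊢ (∀p x (φ ⇒ ψ) ⇒ (∀p x φ ⇒ ∀p x ψ))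
    ax-vac∀   : ∀ x φ → ¬ Occurs x φ → ⊢ (φ ⇒ ∀p x φ)
    ax-exist  : ∀ x y → ¬ (x ≡ y) → ⊢ ∃p x (var x ≐ var y)
    ax-∃→     : ∀ x φ → ⊢ (∃p x φ ⇒ ¬p ∀p x (¬p φ))
    ax-→∃     : ∀ x φ → ⊢ (¬p ∀p x (¬p φ) ⇒ ∃p x φ)
    ax-prop∨l : ∀ φ ψ χ → ⊢ ((φ ∨p ψ) · χ ⇒ φ · χ ∨p ψ · χ)
    ax-prop∨r : ∀ φ ψ χ → ⊢ (χ · (φ ∨p ψ) ⇒ χ · φ ∨p χ · ψ)
    ax-prop∃l : ∀ x φ ψ → ¬ Occurs x ψ → ⊢ ((∃p x φ) · ψ ⇒ ∃p x (φ · ψ))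
    ax-prop∃r : ∀ x φ ψ → ¬ Occurs x ψ → ⊢ (ψ · (∃p x φ) ⇒ ∃p x (ψ · φ))
    ax-⌈⌉l    : ∀ φ ψ → ⊢ (⌈ φ ⌉ · ψ ⇒ ⌈ φ ⌉)
    ax-⌈⌉r    : ∀ φ ψ → ⊢ (ψ · ⌈ φ ⌉ ⇒ ⌈ φ ⌉)
    ax-defvar : ∀ x → ⊢ ⌈ var x ⌉
    ax-def    : ∀ φ → ⊢ (φ ⇒ ⌈ φ ⌉)
    ax-def⊥   : ⊢ (⌈ ⊥p ⌉ ⇒ ⊥p)
    r-mp      : ∀ {φ ψ} → ⊢ φ → ⊢ (φ ⇒ ψ) → ⊢ ψ
    r-trans   : ∀ {φ ψ χ} → ⊢ (φ ⇒ ψ) → ⊢ (ψ ⇒ χ) → ⊢ (φ ⇒ χ)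
    r-curry   : ∀ {φ ψ χ} → ⊢ (φ ∧p ψ ⇒ χ) → ⊢ (φ ⇒ (ψ ⇒ χ))
    r-uncurry : ∀ {φ ψ χ} → ⊢ (φ ⇒ (ψ ⇒ χ)) → ⊢ (φ ∧p ψ ⇒ χ)
    r-∨mono   : ∀ {φ ψ} χ → ⊢ (φ ⇒ ψ) → ⊢ (χ ∨p φ ⇒ χ ∨p ψ)
    r-gen     : ∀ {φ} x → ⊢ φ → ⊢ ∀p x φ
    r-framel  : ∀ {φ ψ} χ → ⊢ (φ ⇒ ψ) → ⊢ (φ · χ ⇒ ψ · χ)
    r-framer  : ∀ {φ ψ} χ → ⊢ (φ ⇒ ψ) → ⊢ (χ · φ ⇒ χ · ψ)

-- The ∃-propagation axioms only allow frames χ in which x does not occur at all,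
-- whereas (iii) only assumes that x is not free in χ.  The gap is closed by
-- renaming the bound occurrences of x in χ, which needs ∀-instantiation.  That is
-- not an axiom: it comes from the witness ∃x (x = z) together with substitutivity
-- of ⌊x ⇔ z⌋, which holds under application because a definedness pattern (and
-- hence the negation of a totality pattern) absorbs application.  Instantiation
-- also gives ∃-introduction, which yields the converse directions of (iii).
-- Parts (i) and (ii) follow from the propagation axioms by induction on C.
module Submission where

open import Data.Empty using (⊥-elim)
open import Data.Nat using (ℕ; suc; s≤s; _⊔_; _<_; _≟_)
open import Data.Nat.Properties using (m⊔n<o⇒m<o; m⊔n<o⇒n<o; m≤m⊔n; m≤n⊔m; >⇒≢)
open import Data.Product using (_×_; _,_; proj₁; proj₂)
open import Data.Unit using (⊤; tt)
open import Function using (_∘_)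
open import Relation.Binary.PropositionalEquality using (_≡_; _≢_; refl; cong; cong₂; subst; ≢-sym)
open import Relation.Nullary using (¬_; yes; no)

open import Defs

module _ {S : Set} (d : S) where
  open MG d renaming (⊢_ to infix 2 ⊢_)

  private variable
    a a' b b' c e : Pat S

  -- Propositional calculus

  infixr 5 _⨾_
  _⨾_ : ⊢ a ⇒ b → ⊢ b ⇒ c → ⊢ a ⇒ c
  _⨾_ = r-trans

  ⇒-refl : ⊢ a ⇒ a
  ⇒-refl {a} = ax-∧dup a ⨾ ax-∧elim a a

  ⇒-const : ⊢ b → ⊢ a ⇒ b
  ⇒-const {b} {a} ⊢b = r-mp ⊢b (r-curry (ax-∧elim b a))

  modus-ponens : ⊢ (a ⇒ b) ∧p a ⇒ b
  modus-ponens = r-uncurry ⇒-refl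

  ∧-intro : ⊢ a → ⊢ b → ⊢ a ∧p b
  ∧-intro ⊢a ⊢b = r-mp ⊢b (r-mp ⊢a (r-curry ⇒-refl))

  ∧-proj₁ : ⊢ a ∧p b ⇒ a
  ∧-proj₁ = ax-∧elim _ _

  ∧-proj₂ : ⊢ a ∧p b ⇒ b
  ∧-proj₂ = ax-∧comm _ _ ⨾ ax-∧elim _ _

  ∧-mapˡ : ⊢ a ⇒ b → ⊢ a ∧p c ⇒ b ∧p c
  ∧-mapˡ p = r-uncurry (p ⨾ r-curry ⇒-refl)

  ∧-mapʳ : ⊢ a ⇒ b → ⊢ c ∧p a ⇒ c ∧p b
  ∧-mapʳ p = ax-∧comm _ _ ⨾ ∧-mapˡ p ⨾ ax-∧comm _ _

  ⟨_,_⟩ : ⊢ a ⇒ b → ⊢ a ⇒ c → ⊢ a ⇒ b ∧p c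
  ⟨ p , q ⟩ = ax-∧dup _ ⨾ ∧-mapˡ p ⨾ ∧-mapʳ q

  ∧-map : ⊢ a ⇒ a' → ⊢ b ⇒ b' → ⊢ a ∧p b ⇒ a' ∧p b'
  ∧-map p q = ⟨ ∧-proj₁ ⨾ p , ∧-proj₂ ⨾ q ⟩

  ∨-inj₁ : ⊢ a ⇒ a ∨p b
  ∨-inj₁ = ax-∨intro _ _

  ∨-inj₂ : ⊢ b ⇒ a ∨p b
  ∨-inj₂ = ax-∨intro _ _ ⨾ ax-∨comm _ _

  ∨-elim : ⊢ a ⇒ c → ⊢ b ⇒ c → ⊢ a ∨p b ⇒ c
  ∨-elim {a} {c} p q = r-∨mono a q ⨾ ax-∨comm _ _ ⨾ r-∨mono c p ⨾ ax-∨idem _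

  ∨-map : ⊢ a ⇒ a' → ⊢ b ⇒ b' → ⊢ a ∨p b ⇒ a' ∨p b'
  ∨-map p q = ∨-elim (p ⨾ ∨-inj₁) (q ⨾ ∨-inj₂)

  ∧-distribˡ-∨ : ⊢ c ∧p (a ∨p b) ⇒ (c ∧p a) ∨p (c ∧p b)
  ∧-distribˡ-∨ = ax-∧comm _ _ ⨾ r-uncurry (∨-elim (r-curry (ax-∧comm _ _ ⨾ ∨-inj₁))
                                                  (r-curry (ax-∧comm _ _ ⨾ ∨-inj₂)))

  contradiction : ⊢ a ∧p ¬p a ⇒ ⊥p
  contradiction = ax-∧comm _ _ ⨾ r-uncurry (ax-¬→ _)

  ¬¬-elim : ⊢ ¬p ¬p a ⇒ a
  ¬¬-elim {a} = ⟨ ⇒-refl , ⇒-const (ax-lem a) ⟩ ⨾ ∧-distribˡ-∨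
              ⨾ ∨-elim ∧-proj₂ (r-uncurry (ax-¬→ (¬p a)) ⨾ ax-⊥ a)

  ¬¬-intro : ⊢ a ⇒ ¬p ¬p a
  ¬¬-intro = r-curry contradiction ⨾ ax-→¬ _

  contraposition : ⊢ a ⇒ b → ⊢ ¬p b ⇒ ¬p a
  contraposition p = r-curry (∧-mapʳ p ⨾ ax-∧comm _ _ ⨾ contradiction) ⨾ ax-→¬ _

  contraposition-¬ˡ : ⊢ ¬p a ⇒ b → ⊢ ¬p b ⇒ a
  contraposition-¬ˡ p = contraposition p ⨾ ¬¬-elim

  ⊢contraposition : ⊢ (a ⇒ b) ⇒ (¬p b ⇒ ¬p a)
  ⊢contraposition = r-curry (r-curry (⟨ ⟨ ∧-proj₁ ⨾ ∧-proj₁ , ∧-proj₂ ⟩ ⨾ modus-ponens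
                                       , ∧-proj₁ ⨾ ∧-proj₂ ⟩ ⨾ contradiction) ⨾ ax-→¬ _)

  ⇒-map : ⊢ a' ⇒ a → ⊢ b ⇒ b' → ⊢ (a ⇒ b) ⇒ (a' ⇒ b')
  ⇒-map p q = r-curry (∧-mapʳ p ⨾ modus-ponens ⨾ q)

  disjunctive-syllogism : ⊢ a ∧p (b ∨p ¬p a) ⇒ b
  disjunctive-syllogism = ∧-distribˡ-∨ ⨾ ∨-elim ∧-proj₂ (contradiction ⨾ ax-⊥ _)

  ∧-excluded-middle : ⊢ a ⇒ (c ∧p a) ∨p ¬p c
  ∧-excluded-middle {a} {c} = ⟨ ⇒-refl , ⇒-const (ax-lem c) ⟩ ⨾ ∧-distribˡ-∨
                            ⨾ ∨-map (ax-∧comm _ _) ∧-proj₂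

  infix 2 _⊣⊢_
  _⊣⊢_ : Pat S → Pat S → Set
  a ⊣⊢ b = (⊢ a ⇒ b) × (⊢ b ⇒ a)

  ⊣⊢-refl : a ⊣⊢ a
  ⊣⊢-refl = ⇒-refl , ⇒-refl

  ⊣⊢-trans : a ⊣⊢ b → b ⊣⊢ c → a ⊣⊢ c
  ⊣⊢-trans (p , q) (p' , q') = p ⨾ p' , q' ⨾ q

  ⊣⊢⇒⇔ : a ⊣⊢ b → ⊢ a ⇔ b
  ⊣⊢⇒⇔ (p , q) = ∧-intro p q

  ¬-cong : a ⊣⊢ a' → ¬p a ⊣⊢ ¬p a'
  ¬-cong (p , q) = contraposition q , contraposition p

  ⇒-cong : a ⊣⊢ a' → b ⊣⊢ b' → (a ⇒ b) ⊣⊢ (a' ⇒ b')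
  ⇒-cong (p , q) (p' , q') = ⇒-map q p' , ⇒-map p q'

  ∧-cong : a ⊣⊢ a' → b ⊣⊢ b' → a ∧p b ⊣⊢ a' ∧p b'
  ∧-cong (p , q) (p' , q') = ∧-map p p' , ∧-map q q'

  ∨-cong : a ⊣⊢ a' → b ⊣⊢ b' → a ∨p b ⊣⊢ a' ∨p b'
  ∨-cong (p , q) (p' , q') = ∨-map p p' , ∨-map q q'

  ·-map : ⊢ a ⇒ a' → ⊢ b ⇒ b' → ⊢ a · b ⇒ a' · b'
  ·-map p q = r-framel _ p ⨾ r-framer _ q

  ·-cong : a ⊣⊢ a' → b ⊣⊢ b' → a · b ⊣⊢ a' · b'
  ·-cong (p , q) (p' , q') = ·-map p p' , ·-map q q'

  -- Quantifiers

  ∀-mono : ∀ x → ⊢ a ⇒ b → ⊢ ∀p x a ⇒ ∀p x b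
  ∀-mono x p = r-mp (r-gen x p) (ax-K∀ x _ _)

  ∃-mono : ∀ x → ⊢ a ⇒ b → ⊢ ∃p x a ⇒ ∃p x b
  ∃-mono x p = ax-∃→ x _ ⨾ contraposition (∀-mono x (contraposition p)) ⨾ ax-→∃ x _

  ∀-cong : ∀ x → a ⊣⊢ b → ∀p x a ⊣⊢ ∀p x b
  ∀-cong x (p , q) = ∀-mono x p , ∀-mono x q

  ∃-cong : ∀ x → a ⊣⊢ b → ∃p x a ⊣⊢ ∃p x b
  ∃-cong x (p , q) = ∃-mono x p , ∃-mono x q

  ∃-cong-dual : ∀ {x y} → ∀p x (¬p a) ⊣⊢ ∀p y (¬p b) → ∃p x a ⊣⊢ ∃p y b
  ∃-cong-dual (p , q) = ax-∃→ _ _ ⨾ contraposition q ⨾ ax-→∃ _ _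
                      , ax-∃→ _ _ ⨾ contraposition p ⨾ ax-→∃ _ _

  ∀-∧ : ∀ x → ⊢ ∀p x a ∧p ∀p x b ⇒ ∀p x (a ∧p b)
  ∀-∧ x = r-uncurry (∀-mono x (r-curry ⇒-refl) ⨾ ax-K∀ x _ _)

  ∀-∃ : ∀ x → ⊢ ∀p x a ∧p ∃p x b ⇒ ∃p x (a ∧p b)
  ∀-∃ x = r-uncurry (∀-mono x (r-curry ⇒-refl) ⨾ ∀-mono x ⊢contraposition ⨾ ax-K∀ x _ _
                    ⨾ ⊢contraposition ⨾ ⇒-map (ax-∃→ x _) (ax-→∃ x _))

  ∃-vacuous : ∀ x a → ¬ Occurs x a → ⊢ ∃p x a ⇒ a
  ∃-vacuous x a x∉a =
    ax-∃→ x a ⨾ contraposition-¬ˡ (ax-vac∀ x (¬p a) λ { (o-¬ o) → x∉a o })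

  -- Definedness

  ⌊⌋-elim : ⊢ ⌊ e ⌋ ⇒ e
  ⌊⌋-elim {e} = contraposition-¬ˡ (ax-def (¬p e))

  ⊥-·ˡ : ∀ χ → ⊢ ⊥p · χ ⇒ ⊥p
  ⊥-·ˡ χ = r-framel χ (ax-def ⊥p) ⨾ ax-⌈⌉l ⊥p χ ⨾ ax-def⊥

  ⊥-·ʳ : ∀ χ → ⊢ χ · ⊥p ⇒ ⊥p
  ⊥-·ʳ χ = r-framer χ (ax-def ⊥p) ⨾ ax-⌈⌉r ⊥p χ ⨾ ax-def⊥

  ¬⌊⌋-·ˡ : ⊢ (¬p ⌊ e ⌋) · b ⇒ ¬p ⌊ e ⌋
  ¬⌊⌋-·ˡ = r-framel _ ¬¬-elim ⨾ ax-⌈⌉l _ _ ⨾ ¬¬-intro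

  ¬⌊⌋-·ʳ : ⊢ b · (¬p ⌊ e ⌋) ⇒ ¬p ⌊ e ⌋
  ¬⌊⌋-·ʳ = r-framer _ ¬¬-elim ⨾ ax-⌈⌉r _ _ ⨾ ¬¬-intro

  ⌊⌋-∧-·ˡ : ⊢ ⌊ e ⌋ ∧p a · b ⇒ (⌊ e ⌋ ∧p a) · b
  ⌊⌋-∧-·ˡ = ∧-mapʳ (r-framel _ ∧-excluded-middle ⨾ ax-prop∨l _ _ _
                    ⨾ ∨-map ⇒-refl ¬⌊⌋-·ˡ)
          ⨾ disjunctive-syllogism

  ⌊⌋-∧-·ʳ : ⊢ ⌊ e ⌋ ∧p b · a ⇒ b · (⌊ e ⌋ ∧p a)
  ⌊⌋-∧-·ʳ = ∧-mapʳ (r-framer _ ∧-excluded-middle ⨾ ax-prop∨r _ _ _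
                    ⨾ ∨-map ⇒-refl ¬⌊⌋-·ʳ)
          ⨾ disjunctive-syllogism

  -- Variables and substitution

  Fresh : EVar → Pat S → Set
  Fresh v (var y) = v ≢ y
  Fresh v (sym _) = ⊤
  Fresh v ⊥p = ⊤
  Fresh v (¬p a) = Fresh v a
  Fresh v (a ⇒ b) = Fresh v a × Fresh v b
  Fresh v (a ∧p b) = Fresh v a × Fresh v b
  Fresh v (a ∨p b) = Fresh v a × Fresh v b
  Fresh v (a · b) = Fresh v a × Fresh v b
  Fresh v (∀p y a) = v ≢ y × Fresh v a
  Fresh v (∃p y a) = v ≢ y × Fresh v a

  NoBinder : EVar → Pat S → Set
  NoBinder v (var y) = ⊤
  NoBinder v (sym _) = ⊤
  NoBinder v ⊥p = ⊤
  NoBinder v (¬p a) = NoBinder v a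
  NoBinder v (a ⇒ b) = NoBinder v a × NoBinder v b
  NoBinder v (a ∧p b) = NoBinder v a × NoBinder v b
  NoBinder v (a ∨p b) = NoBinder v a × NoBinder v b
  NoBinder v (a · b) = NoBinder v a × NoBinder v b
  NoBinder v (∀p y a) = v ≢ y × NoBinder v a
  NoBinder v (∃p y a) = v ≢ y × NoBinder v a

  Fresh⇒¬Occurs : ∀ {v} φ → Fresh v φ → ¬ Occurs v φ
  Fresh⇒¬Occurs (var y) v≢y o-var = v≢y refl
  Fresh⇒¬Occurs (¬p a) v#a (o-¬ o) = Fresh⇒¬Occurs a v#a o
  Fresh⇒¬Occurs (a ⇒ b) (v#a , v#b) (o-⇒l o) = Fresh⇒¬Occurs a v#a o
  Fresh⇒¬Occurs (a ⇒ b) (v#a , v#b) (o-⇒r o) = Fresh⇒¬Occurs b v#b o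
  Fresh⇒¬Occurs (a ∧p b) (v#a , v#b) (o-∧l o) = Fresh⇒¬Occurs a v#a o
  Fresh⇒¬Occurs (a ∧p b) (v#a , v#b) (o-∧r o) = Fresh⇒¬Occurs b v#b o
  Fresh⇒¬Occurs (a ∨p b) (v#a , v#b) (o-∨l o) = Fresh⇒¬Occurs a v#a o
  Fresh⇒¬Occurs (a ∨p b) (v#a , v#b) (o-∨r o) = Fresh⇒¬Occurs b v#b o
  Fresh⇒¬Occurs (a · b) (v#a , v#b) (o-·l o) = Fresh⇒¬Occurs a v#a o
  Fresh⇒¬Occurs (a · b) (v#a , v#b) (o-·r o) = Fresh⇒¬Occurs b v#b o
  Fresh⇒¬Occurs (∀p y a) (v≢y , v#a) o-∀b = v≢y refl
  Fresh⇒¬Occurs (∀p y a) (v≢y , v#a) (o-∀ o) = Fresh⇒¬Occurs a v#a o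
  Fresh⇒¬Occurs (∃p y a) (v≢y , v#a) o-∃b = v≢y refl
  Fresh⇒¬Occurs (∃p y a) (v≢y , v#a) (o-∃ o) = Fresh⇒¬Occurs a v#a o

  Fresh⇒NoBinder : ∀ {v} φ → Fresh v φ → NoBinder v φ
  Fresh⇒NoBinder (var y) _ = tt
  Fresh⇒NoBinder (sym _) _ = tt
  Fresh⇒NoBinder ⊥p _ = tt
  Fresh⇒NoBinder (¬p a) v#a = Fresh⇒NoBinder a v#a
  Fresh⇒NoBinder (a ⇒ b) (v#a , v#b) = Fresh⇒NoBinder a v#a , Fresh⇒NoBinder b v#b
  Fresh⇒NoBinder (a ∧p b) (v#a , v#b) = Fresh⇒NoBinder a v#a , Fresh⇒NoBinder b v#b
  Fresh⇒NoBinder (a ∨p b) (v#a , v#b) = Fresh⇒NoBinder a v#a , Fresh⇒NoBinder b v#b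
  Fresh⇒NoBinder (a · b) (v#a , v#b) = Fresh⇒NoBinder a v#a , Fresh⇒NoBinder b v#b
  Fresh⇒NoBinder (∀p y a) (v≢y , v#a) = v≢y , Fresh⇒NoBinder a v#a
  Fresh⇒NoBinder (∃p y a) (v≢y , v#a) = v≢y , Fresh⇒NoBinder a v#a

  -- Replaces the free occurrences of x by z without avoiding capture; callers rule
  -- capture out by NoBinder z.
  infixl 20 _[_≔_]
  _[_≔_] : Pat S → EVar → EVar → Pat S
  var y [ x ≔ z ] with y ≟ x
  ... | yes _ = var z
  ... | no _ = var y
  sym s [ x ≔ z ] = sym s
  ⊥p [ x ≔ z ] = ⊥p
  (¬p a) [ x ≔ z ] = ¬p (a [ x ≔ z ])
  (a ⇒ b) [ x ≔ z ] = a [ x ≔ z ] ⇒ b [ x ≔ z ]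
  (a ∧p b) [ x ≔ z ] = a [ x ≔ z ] ∧p b [ x ≔ z ]
  (a ∨p b) [ x ≔ z ] = a [ x ≔ z ] ∨p b [ x ≔ z ]
  (a · b) [ x ≔ z ] = a [ x ≔ z ] · b [ x ≔ z ]
  ∀p y a [ x ≔ z ] with y ≟ x
  ... | yes _ = ∀p y a
  ... | no _ = ∀p y (a [ x ≔ z ])
  ∃p y a [ x ≔ z ] with y ≟ x
  ... | yes _ = ∃p y a
  ... | no _ = ∃p y (a [ x ≔ z ])

  [≔]-NoBinder : ∀ {v x z} φ → NoBinder v φ → NoBinder v (φ [ x ≔ z ])
  [≔]-NoBinder {x = x} (var y) _ with y ≟ x
  ... | yes _ = tt
  ... | no _ = tt
  [≔]-NoBinder (sym _) _ = tt
  [≔]-NoBinder ⊥p _ = tt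
  [≔]-NoBinder (¬p a) nb = [≔]-NoBinder a nb
  [≔]-NoBinder (a ⇒ b) (nba , nbb) = [≔]-NoBinder a nba , [≔]-NoBinder b nbb
  [≔]-NoBinder (a ∧p b) (nba , nbb) = [≔]-NoBinder a nba , [≔]-NoBinder b nbb
  [≔]-NoBinder (a ∨p b) (nba , nbb) = [≔]-NoBinder a nba , [≔]-NoBinder b nbb
  [≔]-NoBinder (a · b) (nba , nbb) = [≔]-NoBinder a nba , [≔]-NoBinder b nbb
  [≔]-NoBinder {x = x} (∀p y a) (v≢y , nba) with y ≟ x
  ... | yes _ = v≢y , nba
  ... | no _ = v≢y , [≔]-NoBinder a nba
  [≔]-NoBinder {x = x} (∃p y a) (v≢y , nba) with y ≟ x
  ... | yes _ = v≢y , nba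
  ... | no _ = v≢y , [≔]-NoBinder a nba

  [≔]-Fresh : ∀ {x z} φ → NoBinder x φ → x ≢ z → Fresh x (φ [ x ≔ z ])
  [≔]-Fresh {x} (var y) _ x≢z with y ≟ x
  ... | yes _ = x≢z
  ... | no y≢x = ≢-sym y≢x
  [≔]-Fresh (sym _) _ _ = tt
  [≔]-Fresh ⊥p _ _ = tt
  [≔]-Fresh (¬p a) nb x≢z = [≔]-Fresh a nb x≢z
  [≔]-Fresh (a ⇒ b) (nba , nbb) x≢z = [≔]-Fresh a nba x≢z , [≔]-Fresh b nbb x≢z
  [≔]-Fresh (a ∧p b) (nba , nbb) x≢z = [≔]-Fresh a nba x≢z , [≔]-Fresh b nbb x≢z
  [≔]-Fresh (a ∨p b) (nba , nbb) x≢z = [≔]-Fresh a nba x≢z , [≔]-Fresh b nbb x≢z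
  [≔]-Fresh (a · b) (nba , nbb) x≢z = [≔]-Fresh a nba x≢z , [≔]-Fresh b nbb x≢z
  [≔]-Fresh {x} (∀p y a) (x≢y , nba) x≢z with y ≟ x
  ... | yes refl = ⊥-elim (x≢y refl)
  ... | no _ = x≢y , [≔]-Fresh a nba x≢z
  [≔]-Fresh {x} (∃p y a) (x≢y , nba) x≢z with y ≟ x
  ... | yes refl = ⊥-elim (x≢y refl)
  ... | no _ = x≢y , [≔]-Fresh a nba x≢z

  [≔]-identity : ∀ {x z} φ → Fresh z φ → φ [ z ≔ x ] ≡ φ
  [≔]-identity {z = z} (var y) z≢y with y ≟ z
  ... | yes refl = ⊥-elim (z≢y refl)
  ... | no _ = refl
  [≔]-identity (sym _) _ = refl
  [≔]-identity ⊥p _ = refl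
  [≔]-identity (¬p a) z#a = cong ¬p_ ([≔]-identity a z#a)
  [≔]-identity (a ⇒ b) (z#a , z#b) = cong₂ _⇒_ ([≔]-identity a z#a) ([≔]-identity b z#b)
  [≔]-identity (a ∧p b) (z#a , z#b) = cong₂ _∧p_ ([≔]-identity a z#a) ([≔]-identity b z#b)
  [≔]-identity (a ∨p b) (z#a , z#b) = cong₂ _∨p_ ([≔]-identity a z#a) ([≔]-identity b z#b)
  [≔]-identity (a · b) (z#a , z#b) = cong₂ _·_ ([≔]-identity a z#a) ([≔]-identity b z#b)
  [≔]-identity {z = z} (∀p y a) (_ , z#a) with y ≟ z
  ... | yes _ = refl
  ... | no _ = cong (∀p y) ([≔]-identity a z#a)
  [≔]-identity {z = z} (∃p y a) (_ , z#a) with y ≟ z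
  ... | yes _ = refl
  ... | no _ = cong (∃p y) ([≔]-identity a z#a)

  var[≔] : ∀ x z → var z [ z ≔ x ] ≡ var x
  var[≔] x z with z ≟ z
  ... | yes _ = refl
  ... | no z≢z = ⊥-elim (z≢z refl)

  [≔]-inverse : ∀ {x z} φ → Fresh z φ → φ [ x ≔ z ] [ z ≔ x ] ≡ φ
  [≔]-inverse {x} {z} (var y) z≢y with y ≟ x
  ... | yes refl = var[≔] x z
  ... | no _ = [≔]-identity (var y) z≢y
  [≔]-inverse (sym _) _ = refl
  [≔]-inverse ⊥p _ = refl
  [≔]-inverse (¬p a) z#a = cong ¬p_ ([≔]-inverse a z#a)
  [≔]-inverse (a ⇒ b) (z#a , z#b) = cong₂ _⇒_ ([≔]-inverse a z#a) ([≔]-inverse b z#b)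
  [≔]-inverse (a ∧p b) (z#a , z#b) = cong₂ _∧p_ ([≔]-inverse a z#a) ([≔]-inverse b z#b)
  [≔]-inverse (a ∨p b) (z#a , z#b) = cong₂ _∨p_ ([≔]-inverse a z#a) ([≔]-inverse b z#b)
  [≔]-inverse (a · b) (z#a , z#b) = cong₂ _·_ ([≔]-inverse a z#a) ([≔]-inverse b z#b)
  [≔]-inverse {x} {z} (∀p y a) (z≢y , z#a) with y ≟ x
  ... | yes _ = [≔]-identity (∀p y a) (z≢y , z#a)
  ... | no _ with y ≟ z
  ...   | yes refl = ⊥-elim (z≢y refl)
  ...   | no _ = cong (∀p y) ([≔]-inverse a z#a)
  [≔]-inverse {x} {z} (∃p y a) (z≢y , z#a) with y ≟ x
  ... | yes _ = [≔]-identity (∃p y a) (z≢y , z#a)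
  ... | no _ with y ≟ z
  ...   | yes refl = ⊥-elim (z≢y refl)
  ...   | no _ = cong (∃p y) ([≔]-inverse a z#a)

  maxVar : Pat S → ℕ
  maxVar (var y) = y
  maxVar (sym _) = 0
  maxVar ⊥p = 0
  maxVar (¬p a) = maxVar a
  maxVar (a ⇒ b) = maxVar a ⊔ maxVar b
  maxVar (a ∧p b) = maxVar a ⊔ maxVar b
  maxVar (a ∨p b) = maxVar a ⊔ maxVar b
  maxVar (a · b) = maxVar a ⊔ maxVar b
  maxVar (∀p y a) = y ⊔ maxVar a
  maxVar (∃p y a) = y ⊔ maxVar a

  maxVar<⇒Fresh : ∀ φ {v} → maxVar φ < v → Fresh v φ
  maxVar<⇒Fresh (var y) y<v = >⇒≢ y<v
  maxVar<⇒Fresh (sym _) _ = tt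
  maxVar<⇒Fresh ⊥p _ = tt
  maxVar<⇒Fresh (¬p a) a<v = maxVar<⇒Fresh a a<v
  maxVar<⇒Fresh (a ⇒ b) <v = maxVar<⇒Fresh a (m⊔n<o⇒m<o _ _ <v) , maxVar<⇒Fresh b (m⊔n<o⇒n<o _ _ <v)
  maxVar<⇒Fresh (a ∧p b) <v = maxVar<⇒Fresh a (m⊔n<o⇒m<o _ _ <v) , maxVar<⇒Fresh b (m⊔n<o⇒n<o _ _ <v)
  maxVar<⇒Fresh (a ∨p b) <v = maxVar<⇒Fresh a (m⊔n<o⇒m<o _ _ <v) , maxVar<⇒Fresh b (m⊔n<o⇒n<o _ _ <v)
  maxVar<⇒Fresh (a · b) <v = maxVar<⇒Fresh a (m⊔n<o⇒m<o _ _ <v) , maxVar<⇒Fresh b (m⊔n<o⇒n<o _ _ <v)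
  maxVar<⇒Fresh (∀p y a) <v = >⇒≢ (m⊔n<o⇒m<o _ _ <v) , maxVar<⇒Fresh a (m⊔n<o⇒n<o _ _ <v)
  maxVar<⇒Fresh (∃p y a) <v = >⇒≢ (m⊔n<o⇒m<o _ _ <v) , maxVar<⇒Fresh a (m⊔n<o⇒n<o _ _ <v)

  fresh : EVar → Pat S → EVar
  fresh x ψ = suc (x ⊔ maxVar ψ)

  fresh-≢ : ∀ x ψ → x ≢ fresh x ψ
  fresh-≢ x ψ = ≢-sym (>⇒≢ (s≤s (m≤m⊔n x (maxVar ψ))))

  fresh-Fresh : ∀ x ψ → Fresh (fresh x ψ) ψ
  fresh-Fresh x ψ = maxVar<⇒Fresh ψ (s≤s (m≤n⊔m x (maxVar ψ)))

  unbind : EVar → Pat S → Pat S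
  unbind x (var y) = var y
  unbind x (sym s) = sym s
  unbind x ⊥p = ⊥p
  unbind x (¬p a) = ¬p unbind x a
  unbind x (a ⇒ b) = unbind x a ⇒ unbind x b
  unbind x (a ∧p b) = unbind x a ∧p unbind x b
  unbind x (a ∨p b) = unbind x a ∨p unbind x b
  unbind x (a · b) = unbind x a · unbind x b
  unbind x (∀p y a) with y ≟ x
  ... | yes _ = ∀p (fresh x (unbind x a)) (unbind x a [ x ≔ fresh x (unbind x a) ])
  ... | no _ = ∀p y (unbind x a)
  unbind x (∃p y a) with y ≟ x
  ... | yes _ = ∃p (fresh x (unbind x a)) (unbind x a [ x ≔ fresh x (unbind x a) ])
  ... | no _ = ∃p y (unbind x a)

  unbind-NoBinder : ∀ x φ → NoBinder x (unbind x φ)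
  unbind-NoBinder x (var y) = tt
  unbind-NoBinder x (sym _) = tt
  unbind-NoBinder x ⊥p = tt
  unbind-NoBinder x (¬p a) = unbind-NoBinder x a
  unbind-NoBinder x (a ⇒ b) = unbind-NoBinder x a , unbind-NoBinder x b
  unbind-NoBinder x (a ∧p b) = unbind-NoBinder x a , unbind-NoBinder x b
  unbind-NoBinder x (a ∨p b) = unbind-NoBinder x a , unbind-NoBinder x b
  unbind-NoBinder x (a · b) = unbind-NoBinder x a , unbind-NoBinder x b
  unbind-NoBinder x (∀p y a) with y ≟ x
  ... | yes _ = fresh-≢ x (unbind x a) , [≔]-NoBinder (unbind x a) (unbind-NoBinder x a)
  ... | no y≢x = ≢-sym y≢x , unbind-NoBinder x a
  unbind-NoBinder x (∃p y a) with y ≟ x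
  ... | yes _ = fresh-≢ x (unbind x a) , [≔]-NoBinder (unbind x a) (unbind-NoBinder x a)
  ... | no y≢x = ≢-sym y≢x , unbind-NoBinder x a

  unbind-Fresh : ∀ x φ → ¬ FreeIn x φ → Fresh x (unbind x φ)
  unbind-Fresh x (var y) x∉φ refl = x∉φ f-var
  unbind-Fresh x (sym _) _ = tt
  unbind-Fresh x ⊥p _ = tt
  unbind-Fresh x (¬p a) x∉φ = unbind-Fresh x a (x∉φ ∘ f-¬)
  unbind-Fresh x (a ⇒ b) x∉φ = unbind-Fresh x a (x∉φ ∘ f-⇒l) , unbind-Fresh x b (x∉φ ∘ f-⇒r)
  unbind-Fresh x (a ∧p b) x∉φ = unbind-Fresh x a (x∉φ ∘ f-∧l) , unbind-Fresh x b (x∉φ ∘ f-∧r)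
  unbind-Fresh x (a ∨p b) x∉φ = unbind-Fresh x a (x∉φ ∘ f-∨l) , unbind-Fresh x b (x∉φ ∘ f-∨r)
  unbind-Fresh x (a · b) x∉φ = unbind-Fresh x a (x∉φ ∘ f-·l) , unbind-Fresh x b (x∉φ ∘ f-·r)
  unbind-Fresh x (∀p y a) x∉φ with y ≟ x
  ... | yes _ = fresh-≢ x (unbind x a)
              , [≔]-Fresh (unbind x a) (unbind-NoBinder x a) (fresh-≢ x (unbind x a))
  ... | no y≢x = ≢-sym y≢x , unbind-Fresh x a (x∉φ ∘ f-∀ (≢-sym y≢x))
  unbind-Fresh x (∃p y a) x∉φ with y ≟ x
  ... | yes _ = fresh-≢ x (unbind x a)
              , [≔]-Fresh (unbind x a) (unbind-NoBinder x a) (fresh-≢ x (unbind x a))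
  ... | no y≢x = ≢-sym y≢x , unbind-Fresh x a (x∉φ ∘ f-∃ (≢-sym y≢x))

  -- Substitutivity of equality and instantiation

  module _ {H : Pat S} where

    ¬-under : ⊢ H ∧p b ⇒ a → ⊢ H ∧p ¬p a ⇒ ¬p b
    ¬-under p = r-uncurry (r-curry p ⨾ ⊢contraposition)

    ⇒-under : ⊢ H ∧p a' ⇒ a → ⊢ H ∧p b ⇒ b' → ⊢ H ∧p (a ⇒ b) ⇒ (a' ⇒ b')
    ⇒-under p q = r-curry (⟨ ∧-proj₁ ⨾ ∧-proj₁
                           , ⟨ ∧-proj₁ ⨾ ∧-proj₂ , ∧-mapˡ ∧-proj₁ ⨾ p ⟩ ⨾ modus-ponens ⟩ ⨾ q)

    ∧-under : ⊢ H ∧p a ⇒ a' → ⊢ H ∧p b ⇒ b' → ⊢ H ∧p (a ∧p b) ⇒ a' ∧p b'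
    ∧-under p q = ⟨ ∧-mapʳ ∧-proj₁ ⨾ p , ∧-mapʳ ∧-proj₂ ⨾ q ⟩

    ∨-under : ⊢ H ∧p a ⇒ a' → ⊢ H ∧p b ⇒ b' → ⊢ H ∧p (a ∨p b) ⇒ a' ∨p b'
    ∨-under p q = ∧-distribˡ-∨ ⨾ ∨-map p q

    ∀-under : ∀ y → ¬ Occurs y H → ⊢ H ∧p a ⇒ a' → ⊢ H ∧p ∀p y a ⇒ ∀p y a'
    ∀-under y y∉H p = ∧-mapˡ (ax-vac∀ y H y∉H) ⨾ ∀-∧ y ⨾ ∀-mono y p

    ∃-under : ∀ y → ¬ Occurs y H → ⊢ H ∧p a ⇒ a' → ⊢ H ∧p ∃p y a ⇒ ∃p y a'
    ∃-under y y∉H p = ∧-mapˡ (ax-vac∀ y H y∉H) ⨾ ∀-∃ y ⨾ ∃-mono y p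

  ·-under : ⊢ ⌊ e ⌋ ∧p a ⇒ a' → ⊢ ⌊ e ⌋ ∧p b ⇒ b' → ⊢ ⌊ e ⌋ ∧p (a · b) ⇒ a' · b'
  ·-under p q = ⟨ ∧-proj₁ , ⌊⌋-∧-·ˡ ⨾ r-framel _ p ⟩ ⨾ ⌊⌋-∧-·ʳ ⨾ r-framer _ q

  ≐-subst : ∀ {x z} φ → NoBinder z φ →
            (⊢ (var x ≐ var z) ∧p φ ⇒ φ [ x ≔ z ]) × (⊢ (var x ≐ var z) ∧p φ [ x ≔ z ] ⇒ φ)
  ≐-subst {x} (var y) _ with y ≟ x
  ... | yes refl = ∧-mapˡ (⌊⌋-elim ⨾ ∧-proj₁) ⨾ modus-ponens
                 , ∧-mapˡ (⌊⌋-elim ⨾ ∧-proj₂) ⨾ modus-ponens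
  ... | no _ = ∧-proj₂ , ∧-proj₂
  ≐-subst (sym _) _ = ∧-proj₂ , ∧-proj₂
  ≐-subst ⊥p _ = ∧-proj₂ , ∧-proj₂
  ≐-subst (¬p a) nb = let (p , q) = ≐-subst a nb in ¬-under q , ¬-under p
  ≐-subst (a ⇒ b) (nba , nbb) =
    let (p , q) = ≐-subst a nba ; (p' , q') = ≐-subst b nbb in ⇒-under q p' , ⇒-under p q'
  ≐-subst (a ∧p b) (nba , nbb) =
    let (p , q) = ≐-subst a nba ; (p' , q') = ≐-subst b nbb in ∧-under p p' , ∧-under q q'
  ≐-subst (a ∨p b) (nba , nbb) =
    let (p , q) = ≐-subst a nba ; (p' , q') = ≐-subst b nbb in ∨-under p p' , ∨-under q q'
  ≐-subst (a · b) (nba , nbb) =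
    let (p , q) = ≐-subst a nba ; (p' , q') = ≐-subst b nbb in ·-under p p' , ·-under q q'
  ≐-subst {x} {z} (∀p y a) (z≢y , nba) with y ≟ x
  ... | yes _ = ∧-proj₂ , ∧-proj₂
  ... | no y≢x = let (p , q) = ≐-subst a nba in ∀-under y y∉≐ p , ∀-under y y∉≐ q
    where
      y∉≐ : ¬ Occurs y (var x ≐ var z)
      y∉≐ = Fresh⇒¬Occurs (var x ≐ var z) (tt , (y≢x , ≢-sym z≢y) , (≢-sym z≢y , y≢x))
  ≐-subst {x} {z} (∃p y a) (z≢y , nba) with y ≟ x
  ... | yes _ = ∧-proj₂ , ∧-proj₂
  ... | no y≢x = let (p , q) = ≐-subst a nba in ∃-under y y∉≐ p , ∃-under y y∉≐ q
    where
      y∉≐ : ¬ Occurs y (var x ≐ var z)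
      y∉≐ = Fresh⇒¬Occurs (var x ≐ var z) (tt , (y≢x , ≢-sym z≢y) , (≢-sym z≢y , y≢x))

  ∀-inst : ∀ ψ x z → x ≢ z → NoBinder x ψ → NoBinder z ψ → ⊢ ∀p x ψ ⇒ ψ [ x ≔ z ]
  ∀-inst ψ x z x≢z x∉bψ z∉bψ =
    ⟨ ⇒-refl , ⇒-const (ax-exist x z x≢z) ⟩ ⨾ ∀-∃ x
    ⨾ ∃-mono x (ax-∧comm _ _ ⨾ proj₁ (≐-subst ψ z∉bψ))
    ⨾ ∃-vacuous x _ (Fresh⇒¬Occurs _ ([≔]-Fresh ψ x∉bψ x≢z))

  module _ (ψ : Pat S) {x z : EVar} (x≢z : x ≢ z) (x∉bψ : NoBinder x ψ) (z#ψ : Fresh z ψ) where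

    ∀-inst-back : ⊢ ∀p z (ψ [ x ≔ z ]) ⇒ ψ
    ∀-inst-back = subst (λ ψ' → ⊢ ∀p z (ψ [ x ≔ z ]) ⇒ ψ') ([≔]-inverse ψ z#ψ)
                        (∀-inst (ψ [ x ≔ z ]) z x (≢-sym x≢z)
                                ([≔]-NoBinder ψ (Fresh⇒NoBinder ψ z#ψ)) ([≔]-NoBinder ψ x∉bψ))

    ∀-rename : ∀p x ψ ⊣⊢ ∀p z (ψ [ x ≔ z ])
    ∀-rename =
        ax-vac∀ z (∀p x ψ) (Fresh⇒¬Occurs (∀p x ψ) (≢-sym x≢z , z#ψ))
          ⨾ ∀-mono z (∀-inst ψ x z x≢z x∉bψ (Fresh⇒NoBinder ψ z#ψ))
      , ax-vac∀ x (∀p z (ψ [ x ≔ z ]))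
                (Fresh⇒¬Occurs (∀p z (ψ [ x ≔ z ])) (x≢z , [≔]-Fresh ψ x∉bψ x≢z))
          ⨾ ∀-mono x ∀-inst-back

  ∀-rename-fresh : ∀ x ψ → NoBinder x ψ → ∀p x ψ ⊣⊢ ∀p (fresh x ψ) (ψ [ x ≔ fresh x ψ ])
  ∀-rename-fresh x ψ x∉bψ = ∀-rename ψ (fresh-≢ x ψ) x∉bψ (fresh-Fresh x ψ)

  ∃-rename-fresh : ∀ x ψ → NoBinder x ψ → ∃p x ψ ⊣⊢ ∃p (fresh x ψ) (ψ [ x ≔ fresh x ψ ])
  ∃-rename-fresh x ψ x∉bψ = ∃-cong-dual (∀-rename-fresh x (¬p ψ) x∉bψ)

  unbind-⊣⊢ : ∀ x φ → φ ⊣⊢ unbind x φ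
  unbind-⊣⊢ x (var y) = ⊣⊢-refl
  unbind-⊣⊢ x (sym _) = ⊣⊢-refl
  unbind-⊣⊢ x ⊥p = ⊣⊢-refl
  unbind-⊣⊢ x (¬p a) = ¬-cong (unbind-⊣⊢ x a)
  unbind-⊣⊢ x (a ⇒ b) = ⇒-cong (unbind-⊣⊢ x a) (unbind-⊣⊢ x b)
  unbind-⊣⊢ x (a ∧p b) = ∧-cong (unbind-⊣⊢ x a) (unbind-⊣⊢ x b)
  unbind-⊣⊢ x (a ∨p b) = ∨-cong (unbind-⊣⊢ x a) (unbind-⊣⊢ x b)
  unbind-⊣⊢ x (a · b) = ·-cong (unbind-⊣⊢ x a) (unbind-⊣⊢ x b)
  unbind-⊣⊢ x (∀p y a) with y ≟ x
  ... | yes refl = ⊣⊢-trans (∀-cong x (unbind-⊣⊢ x a))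
                            (∀-rename-fresh x (unbind x a) (unbind-NoBinder x a))
  ... | no _ = ∀-cong y (unbind-⊣⊢ x a)
  unbind-⊣⊢ x (∃p y a) with y ≟ x
  ... | yes refl = ⊣⊢-trans (∃-cong x (unbind-⊣⊢ x a))
                            (∃-rename-fresh x (unbind x a) (unbind-NoBinder x a))
  ... | no _ = ∃-cong y (unbind-⊣⊢ x a)

  -- ax-exist only provides witnesses distinct from x, so instantiating x by itself
  -- goes through a fresh z; unbind first removes the binders on x that ∀-inst forbids.
  ∀-elim : ∀ x φ → ⊢ ∀p x φ ⇒ φ
  ∀-elim x φ = ∀-mono x (proj₁ φ⊣⊢φ') ⨾ proj₁ (∀-rename-fresh x φ' x∉bφ')
             ⨾ ∀-inst-back φ' (fresh-≢ x φ') x∉bφ' (fresh-Fresh x φ') ⨾ proj₂ φ⊣⊢φ'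
    where
      φ' : Pat S
      φ' = unbind x φ
      φ⊣⊢φ' : φ ⊣⊢ φ'
      φ⊣⊢φ' = unbind-⊣⊢ x φ
      x∉bφ' : NoBinder x φ'
      x∉bφ' = unbind-NoBinder x φ

  ∃-intro : ∀ x φ → ⊢ φ ⇒ ∃p x φ
  ∃-intro x φ = ¬¬-intro ⨾ contraposition (∀-elim x (¬p φ)) ⨾ ax-→∃ x φ

  ∃-elim-nonfree : ∀ x β → ¬ FreeIn x β → ⊢ ∃p x β ⇒ β
  ∃-elim-nonfree x β x∉β =
    ∃-mono x (proj₁ β⊣⊢β') ⨾ ∃-vacuous x _ (Fresh⇒¬Occurs _ (unbind-Fresh x β x∉β)) ⨾ proj₂ β⊣⊢β'
    where
      β⊣⊢β' : β ⊣⊢ unbind x β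
      β⊣⊢β' = unbind-⊣⊢ x β

  -- Propagation through application contexts

  ∃-·ˡ : ∀ x α χ → ¬ FreeIn x χ → (∃p x α) · χ ⊣⊢ ∃p x (α · χ)
  ∃-·ˡ x α χ x∉χ =
      r-framer _ (proj₁ χ⊣⊢χ') ⨾ ax-prop∃l x α _ (Fresh⇒¬Occurs _ (unbind-Fresh x χ x∉χ))
        ⨾ ∃-mono x (r-framer _ (proj₂ χ⊣⊢χ'))
    , ∃-mono x (r-framel χ (∃-intro x α))
        ⨾ ∃-elim-nonfree x _ λ { (f-·l (f-∃ x≢x _)) → x≢x refl ; (f-·r x∈χ) → x∉χ x∈χ }
    where
      χ⊣⊢χ' : χ ⊣⊢ unbind x χ
      χ⊣⊢χ' = unbind-⊣⊢ x χ

  ∃-·ʳ : ∀ x α χ → ¬ FreeIn x χ → χ · (∃p x α) ⊣⊢ ∃p x (χ · α)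
  ∃-·ʳ x α χ x∉χ =
      r-framel _ (proj₁ χ⊣⊢χ') ⨾ ax-prop∃r x α _ (Fresh⇒¬Occurs _ (unbind-Fresh x χ x∉χ))
        ⨾ ∃-mono x (r-framel _ (proj₂ χ⊣⊢χ'))
    , ∃-mono x (r-framer χ (∃-intro x α))
        ⨾ ∃-elim-nonfree x _ λ { (f-·r (f-∃ x≢x _)) → x≢x refl ; (f-·l x∈χ) → x∉χ x∈χ }
    where
      χ⊣⊢χ' : χ ⊣⊢ unbind x χ
      χ⊣⊢χ' = unbind-⊣⊢ x χ

  ctx-mono : ∀ C → ⊢ a ⇒ b → ⊢ C [ a ] ⇒ C [ b ]
  ctx-mono □ p = p
  ctx-mono (C ·ₗ χ) p = r-framel χ (ctx-mono C p)
  ctx-mono (χ ·ᵣ C) p = r-framer χ (ctx-mono C p)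

  ctx-⊥ : ∀ C → C [ ⊥p ] ⊣⊢ ⊥p
  ctx-⊥ C = strict C , ax-⊥ _
    where
      strict : ∀ C → ⊢ C [ ⊥p ] ⇒ ⊥p
      strict □ = ⇒-refl
      strict (C ·ₗ χ) = r-framel χ (strict C) ⨾ ⊥-·ˡ χ
      strict (χ ·ᵣ C) = r-framer χ (strict C) ⨾ ⊥-·ʳ χ

  ctx-∨ : ∀ C φ ψ → C [ φ ∨p ψ ] ⊣⊢ C [ φ ] ∨p C [ ψ ]
  ctx-∨ C φ ψ = distrib C , ∨-elim (ctx-mono C ∨-inj₁) (ctx-mono C ∨-inj₂)
    where
      distrib : ∀ C → ⊢ C [ φ ∨p ψ ] ⇒ C [ φ ] ∨p C [ ψ ]
      distrib □ = ⇒-refl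
      distrib (C ·ₗ χ) = r-framel χ (distrib C) ⨾ ax-prop∨l _ _ χ
      distrib (χ ·ᵣ C) = r-framer χ (distrib C) ⨾ ax-prop∨r _ _ χ

  ctx-∃ : ∀ C x φ → ¬ FreeIn x (C [ ∃p x φ ]) → C [ ∃p x φ ] ⊣⊢ ∃p x (C [ φ ])
  ctx-∃ □ x φ _ = ⊣⊢-refl
  ctx-∃ (C ·ₗ χ) x φ x∉Cχ =
    ⊣⊢-trans (·-cong (ctx-∃ C x φ (x∉Cχ ∘ f-·l)) ⊣⊢-refl) (∃-·ˡ x (C [ φ ]) χ (x∉Cχ ∘ f-·r))
  ctx-∃ (χ ·ᵣ C) x φ x∉χC =
    ⊣⊢-trans (·-cong ⊣⊢-refl (ctx-∃ C x φ (x∉χC ∘ f-·r))) (∃-·ʳ x (C [ φ ]) χ (x∉χC ∘ f-·l))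

mainTheorem15 : {S : Set} (d : S) (C : Ctx {S}) (φ ψ : Pat S) →
    let open MG d in
    (⊢ ((C [ ⊥p ]) ⇔ ⊥p))
    × (⊢ ((C [ φ ∨p ψ ]) ⇔ ((C [ φ ]) ∨p (C [ ψ ]))))
    × (∀ (x : EVar) → ¬ FreeIn x (C [ ∃p x φ ]) →
         ⊢ ((C [ ∃p x φ ]) ⇔ ∃p x (C [ φ ])))
mainTheorem15 d C φ ψ =
    ⊣⊢⇒⇔ d (ctx-⊥ d C)
  , ⊣⊢⇒⇔ d (ctx-∨ d C φ ψ)
  , λ x x∉C[∃xφ] → ⊣⊢⇒⇔ d (ctx-∃ d C x φ x∉C[∃xφ])
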